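{- Let $n\ge 0$ and $k\ge 0$. There is a bijection between the set of leaf-marked binary trees $(T,X)$ with $n+1$ unmarked vertices and $k$ marked leaves (i.e. $|X|=k$ and $T$ has $n+k+1$ vertices) and the set of pairs $(P,S)$ where $P$ is a Dyck path of semi-length $n+k+1$ and $S$ is a set of $k$ $UDD$-patterns of $P$ none of which contains a down-step of the last run of down-steps of $P$.
   Context: A binary tree is a rooted plane tree in which each vertex has at most two children, each designated as left or right child. A leaf is a vertex with no children. The rightmost leaf of $T$ is the leaf reached by starting at the root and descending, taking the right child whenever possible and otherwise the left child (the last leaf in preorder). A leaf-marked binary tree is a pair $(T,X)$ where $X$ is a set of leaves of $T$ not containing the rightmost leaf; vertices in $X$ are marked, all others unmarked. A Dyck path of semi-length $m$ is a word in $\{U,D\}$ with $m$ letters of each kind such that every prefix has at least as many $U$'s as $D$'s. The last run of down-steps is the maximal final block of $D$'s; a $UDD$-pattern is an occurrence of three consecutive letters $U,D,D$. -}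

module Defs where

open import Data.Nat using (ℕ; zero; suc; _+_; _∸_; _≤ᵇ_)
open import Data.Bool using (Bool; true; false; _∧_; _∨_; not; if_then_else_)
open import Data.Maybe using (Maybe; just; nothing)
open import Data.List using (List; []; _∷_; length; reverse)
open import Data.Bool.ListAction using (and)
open import Data.Vec using (Vec; []; _∷_; toList; zipWith)
open import Data.Fin using (Fin; toℕ)
open import Data.Fin.Subset using (Subset; ∣_∣)
import Data.Vec
import Data.Nat
open import Data.Product using (Σ; _×_)
open import Relation.Binary.PropositionalEquality using (_≡_)

data Tree : Set where
  node : Maybe Tree → Maybe Tree → Tree

mutual
  size : Tree → ℕ
  size (node l r) = suc (sizeM l + sizeM r)

  sizeM : Maybe Tree → ℕ
  sizeM nothing  = 0
  sizeM (just t) = size t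

numLeaves : Tree → ℕ
numLeaves (node nothing nothing) = 1
numLeaves (node nothing (just r)) = numLeaves r
numLeaves (node (just l) nothing) = numLeaves l
numLeaves (node (just l) (just r)) = numLeaves l + numLeaves r

-- Leaves are indexed by Fin (numLeaves T) in preorder (left to right),
-- so the rightmost leaf is the one with the last index.
-- A set of leaves X is a Subset (numLeaves T).

lastBit : ∀ {m} → Vec Bool m → Bool
lastBit []           = false
lastBit (x ∷ [])     = x
lastBit (x ∷ y ∷ v)  = lastBit (y ∷ v)

LeafMarked : ℕ → ℕ → Set
LeafMarked n k =
  Σ Tree λ T → Σ (Subset (numLeaves T)) λ X →
    (size T ≡ n + k + 1) × (∣ X ∣ ≡ k) × (lastBit X ≡ false)

data Step : Set where
  U D : Step

isDyckFrom : ℕ → List Step → Bool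
isDyckFrom zero    []      = true
isDyckFrom (suc h) []      = false
isDyckFrom h       (U ∷ w) = isDyckFrom (suc h) w
isDyckFrom zero    (D ∷ w) = false
isDyckFrom (suc h) (D ∷ w) = isDyckFrom h w

isDyck : List Step → Bool
isDyck = isDyckFrom 0

at : List Step → ℕ → Maybe Step
at []      _       = nothing
at (s ∷ w) zero    = just s
at (s ∷ w) (suc i) = at w i

isU : Maybe Step → Bool
isU (just U) = true
isU _        = false

isD : Maybe Step → Bool
isD (just D) = true
isD _        = false

uddAt : List Step → ℕ → Bool
uddAt w i = isU (at w i) ∧ isD (at w (suc i)) ∧ isD (at w (suc (suc i)))

trailingDsRev : List Step → ℕ
trailingDsRev (D ∷ w) = suc (trailingDsRev w)
trailingDsRev _       = 0

trailingDs : List Step → ℕ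
trailingDs w = trailingDsRev (reverse w)

inLastRun : List Step → ℕ → Bool
inLastRun w j = (length w ∸ trailingDs w) ≤ᵇ j

goodPattern : List Step → ℕ → Bool
goodPattern w i =
  uddAt w i ∧ not (inLastRun w (suc i)) ∧ not (inLastRun w (suc (suc i)))

patternSetOK : (w : List Step) → Subset (length w) → Bool
patternSetOK w S =
  and (toList (zipWith (λ b i → not b ∨ goodPattern w (toℕ i)) S (Data.Vec.allFin _)))

-- pairs (P,S): P Dyck of semi-length n+k+1, S a set of k admissible
-- UDD-patterns (identified by their starting positions)
DyckMarked : ℕ → ℕ → Set
DyckMarked n k =
  Σ (List Step) λ P → Σ (Subset (length P)) λ S →
    (isDyck P ≡ true) × (length P ≡ 2 Data.Nat.* (n + k + 1)) ×
    (∣ S ∣ ≡ k) × (patternSetOK P S ≡ true)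

-- A binary tree T is sent to the Dyck path φ(T) = U φ(L) D φ(R), where L and R
-- are the subtrees of the root and φ of an empty subtree is empty.  Under φ the
-- UDD-patterns are the UD's of those leaves that are followed by a further D,
-- and such a pattern avoids the last run of down-steps iff some up-step follows
-- it, i.e. iff its leaf is not the rightmost one.  So marking the U of every
-- marked leaf carries leaf-marked trees to Dyck paths with admissible pattern
-- sets, and φ is inverted by reading the path from the right with a stack of
-- subtrees.

module Submission where

open import Defs
open import Axiom.UniquenessOfIdentityProofs.WithK using (uip)
open import Data.Bool using (Bool; true; false; _∧_; _∨_; not)
open import Data.Bool.Properties using (∧-conicalʳ; ∧-idem; ∧-identityʳ; ∨-identityʳ; ∨-zeroʳ; not-involutive)
open import Data.Bool.ListAction using (and)
open import Data.Fin as Fin using (Fin; toℕ)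
open import Data.Fin.Subset using (Subset; ∣_∣)
open import Data.List using (List; []; _∷_; _++_; _∷ʳ_; length; map; foldr; reverse; drop)
open import Data.List.Properties using (foldr-++; ∷ʳ-injectiveˡ; length-reverse; reverse-involutive; unfold-reverse)
open import Data.Maybe using (Maybe; just; nothing)
open import Data.Nat using (ℕ; zero; suc; _+_; _*_; _∸_; _≤ᵇ_; _≤_; z≤n; s≤s)
open import Data.Nat.Properties using (*-cancelˡ-≡; +-assoc; +-comm; suc-injective; ≤-trans; m≤m+n)
open import Data.Nat.Tactic.RingSolver using (solve-∀)
open import Data.Product using (Σ; _×_; _,_; proj₁; proj₂; uncurry; map₁; map₂)
open import Data.Product.Algebra using (Σ-assoc)
open import Data.Product.Function.Dependent.Propositional using (Σ-↔)
open import Data.Product.Properties using (Σ-≡,≡→≡)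
open import Data.Vec as Vec using (Vec; []; _∷_; toList; zipWith; allFin; tabulate)
open import Data.Vec.Properties using (++-injective; take++drop≡id; tabulate-∘; zipWith-map₂)
open import Function using (_∘_; _$_; id)
open import Function.Bundles using (_↔_; _⤖_; _⇔_; mk↔ₛ′; mk⇔; Equivalence)
open import Function.Properties.Inverse using (↔-refl; ↔⇒⤖)
open import Function.Related.Propositional using (module EquationalReasoning)
open import Level using (Level)
open import Relation.Binary.PropositionalEquality
open import Relation.Nullary using (Irrelevant; contradiction)

×-irrelevant : ∀ {a b} {A : Set a} {B : Set b} → Irrelevant A → Irrelevant B → Irrelevant (A × B)
×-irrelevant A-irr B-irr (x , y) (x′ , y′) = cong₂ _,_ (A-irr x x′) (B-irr y y′)

module _ {a b p q : Level} {A : Set a} {B : Set b} {P : A → Set p} {Q : B → Set q} where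

  Σ-restrict-↔ : (f : A → B) (g : B → A) →
                 (∀ x → g (f x) ≡ x) → (∀ {y} → Q y → f (g y) ≡ y) →
                 (∀ x → P x ⇔ Q (f x)) →
                 (∀ x → Irrelevant (P x)) → (∀ y → Irrelevant (Q y)) →
                 Σ A P ↔ Σ B Q
  Σ-restrict-↔ f g g∘f f∘g P⇔Q P-irr Q-irr = mk↔ₛ′ to from to∘from from∘to
    where
    to : Σ A P → Σ B Q
    to (x , p) = f x , Equivalence.to (P⇔Q x) p

    from : Σ B Q → Σ A P
    from (y , q) = g y , Equivalence.from (P⇔Q (g y)) (subst Q (sym (f∘g q)) q)

    to∘from : ∀ z → to (from z) ≡ z
    to∘from (y , q) = Σ-≡,≡→≡ (f∘g q , Q-irr y _ _)

    from∘to : ∀ z → from (to z) ≡ z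
    from∘to (x , p) = Σ-≡,≡→≡ (g∘f x , P-irr x _ _)

hasU : List Step → Bool
hasU []      = false
hasU (U ∷ _) = true
hasU (D ∷ P) = hasU P

sucIfNonZero : ℕ → ℕ
sucIfNonZero zero    = zero
sucIfNonZero (suc i) = suc (suc i)

-- The number of steps up to and including the last U.
lastRunStart : List Step → ℕ
lastRunStart []      = 0
lastRunStart (U ∷ P) = suc (lastRunStart P)
lastRunStart (D ∷ P) = sucIfNonZero (lastRunStart P)

lastRunStart-∷ʳ-D : ∀ P → lastRunStart (P ∷ʳ D) ≡ lastRunStart P
lastRunStart-∷ʳ-D []      = refl
lastRunStart-∷ʳ-D (U ∷ P) = cong suc (lastRunStart-∷ʳ-D P)
lastRunStart-∷ʳ-D (D ∷ P) = cong sucIfNonZero (lastRunStart-∷ʳ-D P)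

lastRunStart-∷ʳ-U : ∀ P → lastRunStart (P ∷ʳ U) ≡ suc (length P)
lastRunStart-∷ʳ-U []      = refl
lastRunStart-∷ʳ-U (U ∷ P) = cong suc (lastRunStart-∷ʳ-U P)
lastRunStart-∷ʳ-U (D ∷ P) = cong sucIfNonZero (lastRunStart-∷ʳ-U P)

lastRunStart-reverse : ∀ R → lastRunStart (reverse R) ≡ length R ∸ trailingDsRev R
lastRunStart-reverse [] = refl
lastRunStart-reverse (U ∷ R) = begin
  lastRunStart (reverse (U ∷ R)) ≡⟨ cong lastRunStart (unfold-reverse U R) ⟩
  lastRunStart (reverse R ∷ʳ U)  ≡⟨ lastRunStart-∷ʳ-U (reverse R) ⟩
  suc (length (reverse R))       ≡⟨ cong suc (length-reverse R) ⟩
  suc (length R)                 ∎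
  where open ≡-Reasoning
lastRunStart-reverse (D ∷ R) = begin
  lastRunStart (reverse (D ∷ R)) ≡⟨ cong lastRunStart (unfold-reverse D R) ⟩
  lastRunStart (reverse R ∷ʳ D)  ≡⟨ lastRunStart-∷ʳ-D (reverse R) ⟩
  lastRunStart (reverse R)       ≡⟨ lastRunStart-reverse R ⟩
  length R ∸ trailingDsRev R     ∎
  where open ≡-Reasoning

length∸trailingDs : ∀ P → length P ∸ trailingDs P ≡ lastRunStart P
length∸trailingDs P = begin
  length P ∸ trailingDs P                        ≡⟨ cong (_∸ trailingDs P) (length-reverse P) ⟨
  length (reverse P) ∸ trailingDsRev (reverse P) ≡⟨ lastRunStart-reverse (reverse P) ⟨
  lastRunStart (reverse (reverse P))             ≡⟨ cong lastRunStart (reverse-involutive P) ⟩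
  lastRunStart P                                 ∎
  where open ≡-Reasoning

hasU-drop : ∀ m P → hasU (drop m P) ≡ not (lastRunStart P ≤ᵇ m)
hasU-drop zero    []      = refl
hasU-drop (suc m) []      = refl
hasU-drop zero    (U ∷ P) = refl
hasU-drop (suc m) (U ∷ P) = trans (hasU-drop m P) (cong not (suc-≤ᵇ-suc (lastRunStart P)))
  where
  suc-≤ᵇ-suc : ∀ i → (i ≤ᵇ m) ≡ (suc i ≤ᵇ suc m)
  suc-≤ᵇ-suc zero    = refl
  suc-≤ᵇ-suc (suc i) = refl
hasU-drop zero    (D ∷ P) = trans (hasU-drop zero P) (cong not (sucIfNonZero-≤ᵇ-0 (lastRunStart P)))
  where
  sucIfNonZero-≤ᵇ-0 : ∀ i → (i ≤ᵇ 0) ≡ (sucIfNonZero i ≤ᵇ 0)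
  sucIfNonZero-≤ᵇ-0 zero    = refl
  sucIfNonZero-≤ᵇ-0 (suc i) = refl
hasU-drop (suc m) (D ∷ P) = trans (hasU-drop m P) (cong not (sucIfNonZero-≤ᵇ-suc (lastRunStart P)))
  where
  sucIfNonZero-≤ᵇ-suc : ∀ i → (i ≤ᵇ m) ≡ (sucIfNonZero i ≤ᵇ suc m)
  sucIfNonZero-≤ᵇ-suc zero    = refl
  sucIfNonZero-≤ᵇ-suc (suc i) = refl

not-inLastRun : ∀ P m → not (inLastRun P m) ≡ hasU (drop m P)
not-inLastRun P m = trans (cong (λ i → not (i ≤ᵇ m)) (length∸trailingDs P)) (sym (hasU-drop m P))

-- A UDD-pattern avoids the last run of down-steps iff some up-step follows it.
startsGoodUDD : List Step → Bool
startsGoodUDD (U ∷ D ∷ D ∷ P) = hasU P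
startsGoodUDD _               = false

goodPattern-drop : ∀ P i → goodPattern P i ≡ startsGoodUDD (drop i P)
goodPattern-drop P i rewrite not-inLastRun P (suc i) | not-inLastRun P (suc (suc i)) = atDrop i P
  where
  atDrop : ∀ i P → uddAt P i ∧ hasU (drop (suc i) P) ∧ hasU (drop (suc (suc i)) P) ≡ startsGoodUDD (drop i P)
  atDrop zero    (U ∷ D ∷ D ∷ P) = ∧-idem (hasU P)
  atDrop zero    []              = refl
  atDrop zero    (D ∷ P)         = refl
  atDrop zero    (U ∷ [])        = refl
  atDrop zero    (U ∷ U ∷ P)     = refl
  atDrop zero    (U ∷ D ∷ [])    = refl
  atDrop zero    (U ∷ D ∷ U ∷ P) = refl
  atDrop (suc i) []              = refl
  atDrop (suc i) (s ∷ P)         = atDrop i P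

allMarked : ∀ {n} → (ℕ → Bool) → Subset n → Bool
allMarked p []      = true
allMarked p (b ∷ S) = (not b ∨ p 0) ∧ allMarked (p ∘ suc) S

allMarked-cong : ∀ {n} {p q : ℕ → Bool} → (∀ i → p i ≡ q i) → (S : Subset n) → allMarked p S ≡ allMarked q S
allMarked-cong p≡q []      = refl
allMarked-cong p≡q (b ∷ S) = cong₂ _∧_ (cong (not b ∨_) (p≡q 0)) (allMarked-cong (p≡q ∘ suc) S)

and-zipWith-allFin : ∀ {n} p (S : Subset n) →
                     and (toList (zipWith (λ b i → not b ∨ p (toℕ i)) S (allFin n))) ≡ allMarked p S
and-zipWith-allFin p [] = refl
and-zipWith-allFin {suc n} p (b ∷ S) = cong ((not b ∨ p 0) ∧_) $ begin
  and (toList (zipWith G S (tabulate Fin.suc)))             ≡⟨ cong (and ∘ toList ∘ zipWith G S) (tabulate-∘ Fin.suc id) ⟩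
  and (toList (zipWith G S (Vec.map Fin.suc (allFin n))))   ≡⟨ cong (and ∘ toList) (zipWith-map₂ G Fin.suc S (allFin n)) ⟩
  and (toList (zipWith (λ b i → G b (Fin.suc i)) S (allFin n))) ≡⟨ and-zipWith-allFin (p ∘ suc) S ⟩
  allMarked (p ∘ suc) S                                      ∎
  where
  open ≡-Reasoning
  G : Bool → Fin (suc n) → Bool
  G b i = not b ∨ p (toℕ i)

patternSetOK≡allMarked : ∀ P S → patternSetOK P S ≡ allMarked (λ i → startsGoodUDD (drop i P)) S
patternSetOK≡allMarked P S = trans (and-zipWith-allFin (goodPattern P) S) (allMarked-cong (goodPattern-drop P) S)

data MarkedTree : Set where
  leaf  : Bool → MarkedTree
  left  : MarkedTree → MarkedTree
  right : MarkedTree → MarkedTree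
  both  : MarkedTree → MarkedTree → MarkedTree

shape : MarkedTree → Tree
shape (leaf _)   = node nothing nothing
shape (left l)   = node (just (shape l)) nothing
shape (right r)  = node nothing (just (shape r))
shape (both l r) = node (just (shape l)) (just (shape r))

leafMarks : (t : MarkedTree) → Subset (numLeaves (shape t))
leafMarks (leaf b)   = b ∷ []
leafMarks (left l)   = leafMarks l
leafMarks (right r)  = leafMarks r
leafMarks (both l r) = leafMarks l Vec.++ leafMarks r

markLeaves : (T : Tree) → Subset (numLeaves T) → MarkedTree
markLeaves (node nothing  nothing)  (b ∷ []) = leaf b
markLeaves (node (just l) nothing)  X        = left (markLeaves l X)
markLeaves (node nothing  (just r)) X        = right (markLeaves r X)
markLeaves (node (just l) (just r)) X        =
  both (markLeaves l (Vec.take (numLeaves l) X)) (markLeaves r (Vec.drop (numLeaves l) X))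

toLeafSet : MarkedTree → Σ Tree (Subset ∘ numLeaves)
toLeafSet t = shape t , leafMarks t

take-drop-++ : ∀ {a} {A : Set a} {m n} (xs : Vec A m) (ys : Vec A n) →
               Vec.take m (xs Vec.++ ys) ≡ xs × Vec.drop m (xs Vec.++ ys) ≡ ys
take-drop-++ {m = m} xs ys = ++-injective (Vec.take m (xs Vec.++ ys)) xs (take++drop≡id m (xs Vec.++ ys))

markLeaves-shape : ∀ t → markLeaves (shape t) (leafMarks t) ≡ t
markLeaves-shape (leaf b)   = refl
markLeaves-shape (left l)   = cong left (markLeaves-shape l)
markLeaves-shape (right r)  = cong right (markLeaves-shape r)
markLeaves-shape (both l r) = cong₂ both
  (trans (cong (markLeaves (shape l)) (proj₁ (take-drop-++ (leafMarks l) (leafMarks r)))) (markLeaves-shape l))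
  (trans (cong (markLeaves (shape r)) (proj₂ (take-drop-++ (leafMarks l) (leafMarks r)))) (markLeaves-shape r))

toLeafSet-markLeaves : ∀ T X → toLeafSet (markLeaves T X) ≡ (T , X)
toLeafSet-markLeaves (node nothing nothing) (b ∷ []) = refl
toLeafSet-markLeaves (node (just l) nothing) X =
  cong (λ (T , Y) → node (just T) nothing , Y) (toLeafSet-markLeaves l X)
toLeafSet-markLeaves (node nothing (just r)) X =
  cong (λ (T , Y) → node nothing (just T) , Y) (toLeafSet-markLeaves r X)
toLeafSet-markLeaves (node (just l) (just r)) X = trans
  (cong₂ (λ (T , Y) (T′ , Y′) → node (just T) (just T′) , Y Vec.++ Y′)
         (toLeafSet-markLeaves l (Vec.take m X)) (toLeafSet-markLeaves r (Vec.drop m X)))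
  (cong (node (just l) (just r) ,_) (take++drop≡id m X))
  where
  m : ℕ
  m = numLeaves l

markedTree↔ : MarkedTree ↔ Σ Tree (Subset ∘ numLeaves)
markedTree↔ = mk↔ₛ′ toLeafSet (uncurry markLeaves) (uncurry toLeafSet-markLeaves) markLeaves-shape

rightmostMark : MarkedTree → Bool
rightmostMark (leaf b)   = b
rightmostMark (left l)   = rightmostMark l
rightmostMark (right r)  = rightmostMark r
rightmostMark (both _ r) = rightmostMark r

numLeaves-positive : ∀ t → 1 ≤ numLeaves (shape t)
numLeaves-positive (leaf _)   = s≤s z≤n
numLeaves-positive (left l)   = numLeaves-positive l
numLeaves-positive (right r)  = numLeaves-positive r
numLeaves-positive (both l r) = ≤-trans (numLeaves-positive l) (m≤m+n _ _)

lastBit-++ : ∀ {m n} (xs : Vec Bool m) (ys : Vec Bool n) → 1 ≤ n → lastBit (xs Vec.++ ys) ≡ lastBit ys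
lastBit-++ []            ys       _ = refl
lastBit-++ (x ∷ [])      (y ∷ ys) _ = refl
lastBit-++ (x ∷ x′ ∷ xs) (y ∷ ys) p = lastBit-++ (x′ ∷ xs) (y ∷ ys) p

lastBit-leafMarks : ∀ t → lastBit (leafMarks t) ≡ rightmostMark t
lastBit-leafMarks (leaf b)   = refl
lastBit-leafMarks (left l)   = lastBit-leafMarks l
lastBit-leafMarks (right r)  = lastBit-leafMarks r
lastBit-leafMarks (both l r) =
  trans (lastBit-++ (leafMarks l) (leafMarks r) (numLeaves-positive r)) (lastBit-leafMarks r)

∣++∣ : ∀ {m n} (xs : Subset m) (ys : Subset n) → ∣ xs Vec.++ ys ∣ ≡ ∣ xs ∣ + ∣ ys ∣
∣++∣ []           ys = refl
∣++∣ (true ∷ xs)  ys = cong suc (∣++∣ xs ys)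
∣++∣ (false ∷ xs) ys = ∣++∣ xs ys

MStep : Set
MStep = Step × Bool

pattern up b = U , b
pattern down = D , false

Word : Set
Word = List MStep

steps : Word → List Step
steps = map proj₁

stepMarks : (w : Word) → Subset (length (steps w))
stepMarks []            = []
stepMarks ((_ , b) ∷ w) = b ∷ stepMarks w

markSteps : (P : List Step) → Subset (length P) → Word
markSteps []      []      = []
markSteps (s ∷ P) (b ∷ S) = (s , b) ∷ markSteps P S

toMarkedPath : Word → Σ (List Step) (Subset ∘ length)
toMarkedPath w = steps w , stepMarks w

toMarkedPath-markSteps : ∀ P S → toMarkedPath (markSteps P S) ≡ (P , S)
toMarkedPath-markSteps []      []      = refl
toMarkedPath-markSteps (s ∷ P) (b ∷ S) = cong (λ (P′ , S′) → s ∷ P′ , b ∷ S′) (toMarkedPath-markSteps P S)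

markSteps-toMarkedPath : ∀ w → markSteps (steps w) (stepMarks w) ≡ w
markSteps-toMarkedPath []      = refl
markSteps-toMarkedPath (x ∷ w) = cong (x ∷_) (markSteps-toMarkedPath w)

word↔ : Word ↔ Σ (List Step) (Subset ∘ length)
word↔ = mk↔ₛ′ toMarkedPath (uncurry markSteps) (uncurry toMarkedPath-markSteps) markSteps-toMarkedPath

marksGood : Word → Bool
marksGood w = allMarked (λ i → startsGoodUDD (drop i (steps w))) (stepMarks w)

-- encode t rest is φ(t) followed by rest; the U of a leaf carries its mark.
encode : MarkedTree → Word → Word
encode (leaf b)   rest = up b ∷ down ∷ rest
encode (left l)   rest = up false ∷ encode l (down ∷ rest)
encode (right r)  rest = up false ∷ down ∷ encode r rest
encode (both l r) rest = up false ∷ encode l (down ∷ encode r rest)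

path : MarkedTree → Word
path t = encode t []

encode-++ : ∀ t xs ys → encode t xs ++ ys ≡ encode t (xs ++ ys)
encode-++ (leaf b)   xs ys = refl
encode-++ (left l)   xs ys = cong (up false ∷_) (encode-++ l (down ∷ xs) ys)
encode-++ (right r)  xs ys = cong (λ w → up false ∷ down ∷ w) (encode-++ r xs ys)
encode-++ (both l r) xs ys = cong (up false ∷_) $
  trans (encode-++ l (down ∷ encode r xs) ys) (cong (λ w → encode l (down ∷ w)) (encode-++ r xs ys))

isDyckFrom-U : ∀ h w → isDyckFrom h (U ∷ w) ≡ isDyckFrom (suc h) w
isDyckFrom-U zero    w = refl
isDyckFrom-U (suc h) w = refl

isDyckFrom-encode : ∀ t h rest → isDyckFrom h (steps (encode t rest)) ≡ isDyckFrom h (steps rest)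
isDyckFrom-encode (leaf b)   h rest = isDyckFrom-U h _
isDyckFrom-encode (left l)   h rest = trans (isDyckFrom-U h _) (isDyckFrom-encode l (suc h) (down ∷ rest))
isDyckFrom-encode (right r)  h rest = trans (isDyckFrom-U h _) (isDyckFrom-encode r h rest)
isDyckFrom-encode (both l r) h rest = begin
  isDyckFrom h (steps (encode (both l r) rest))                ≡⟨ isDyckFrom-U h _ ⟩
  isDyckFrom (suc h) (steps (encode l (down ∷ encode r rest))) ≡⟨ isDyckFrom-encode l (suc h) _ ⟩
  isDyckFrom h (steps (encode r rest))                         ≡⟨ isDyckFrom-encode r h rest ⟩
  isDyckFrom h (steps rest)                                    ∎
  where open ≡-Reasoning

length-encode : ∀ t rest → length (steps (encode t rest)) ≡ 2 * size (shape t) + length (steps rest)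
length-encode (leaf b)   rest = refl
length-encode (left l)   rest
  rewrite length-encode l (down ∷ rest) = arith (size (shape l)) (length (steps rest))
  where
  arith : ∀ a L → suc (2 * a + suc L) ≡ 2 * suc (a + 0) + L
  arith = solve-∀
length-encode (right r)  rest
  rewrite length-encode r rest = arith (size (shape r)) (length (steps rest))
  where
  arith : ∀ a L → suc (suc (2 * a + L)) ≡ 2 * suc a + L
  arith = solve-∀
length-encode (both l r) rest
  rewrite length-encode l (down ∷ encode r rest) | length-encode r rest =
  arith (size (shape l)) (size (shape r)) (length (steps rest))
  where
  arith : ∀ a b L → suc (2 * a + suc (2 * b + L)) ≡ 2 * suc (a + b) + L
  arith = solve-∀

∣stepMarks-encode∣ : ∀ t rest → ∣ stepMarks (encode t rest) ∣ ≡ ∣ leafMarks t ∣ + ∣ stepMarks rest ∣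
∣stepMarks-encode∣ (leaf true)  rest = refl
∣stepMarks-encode∣ (leaf false) rest = refl
∣stepMarks-encode∣ (left l)     rest = ∣stepMarks-encode∣ l (down ∷ rest)
∣stepMarks-encode∣ (right r)    rest = ∣stepMarks-encode∣ r rest
∣stepMarks-encode∣ (both l r)   rest = begin
  ∣ stepMarks (encode l (down ∷ encode r rest)) ∣            ≡⟨ ∣stepMarks-encode∣ l (down ∷ encode r rest) ⟩
  ∣ leafMarks l ∣ + ∣ stepMarks (encode r rest) ∣             ≡⟨ cong (∣ leafMarks l ∣ +_) (∣stepMarks-encode∣ r rest) ⟩
  ∣ leafMarks l ∣ + (∣ leafMarks r ∣ + ∣ stepMarks rest ∣)   ≡⟨ +-assoc ∣ leafMarks l ∣ _ _ ⟨
  ∣ leafMarks l ∣ + ∣ leafMarks r ∣ + ∣ stepMarks rest ∣     ≡⟨ cong (_+ ∣ stepMarks rest ∣) (∣++∣ (leafMarks l) (leafMarks r)) ⟨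
  ∣ leafMarks l Vec.++ leafMarks r ∣ + ∣ stepMarks rest ∣    ∎
  where open ≡-Reasoning

hasU-encode : ∀ t rest → hasU (steps (encode t rest)) ≡ true
hasU-encode (leaf _)   rest = refl
hasU-encode (left _)   rest = refl
hasU-encode (right _)  rest = refl
hasU-encode (both _ _) rest = refl

marksGood-encode : ∀ t rest →
                   marksGood (encode t (down ∷ rest)) ≡ (not (rightmostMark t) ∨ hasU (steps rest)) ∧ marksGood rest
marksGood-encode (leaf b)   rest = refl
marksGood-encode (left l)   rest = marksGood-encode l (down ∷ rest)
marksGood-encode (right r)  rest = marksGood-encode r rest
marksGood-encode (both l r) rest
  rewrite marksGood-encode l (encode r (down ∷ rest)) | hasU-encode r (down ∷ rest)
        | ∨-zeroʳ (not (rightmostMark l)) = marksGood-encode r rest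

marksGood-path : ∀ t → marksGood (path t) ≡ not (rightmostMark t)
marksGood-path (leaf b)   rewrite ∨-identityʳ (not b) = ∧-identityʳ (not b)
marksGood-path (left l)   rewrite marksGood-encode l [] | ∨-identityʳ (not (rightmostMark l)) = ∧-identityʳ _
marksGood-path (right r)  = marksGood-path r
marksGood-path (both l r) rewrite marksGood-encode l (encode r []) | hasU-encode r []
                                | ∨-zeroʳ (not (rightmostMark l)) = marksGood-path r

patternSetOK≡marksGood : ∀ w → patternSetOK (steps w) (stepMarks w) ≡ marksGood w
patternSetOK≡marksGood w = patternSetOK≡allMarked (steps w) (stepMarks w)

isDyck-path : ∀ t → isDyck (steps (path t)) ≡ true
isDyck-path t = isDyckFrom-encode t 0 []

length-path : ∀ t → length (steps (path t)) ≡ 2 * size (shape t)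
length-path t = trans (length-encode t []) (+-comm _ 0)

∣stepMarks-path∣ : ∀ t → ∣ stepMarks (path t) ∣ ≡ ∣ leafMarks t ∣
∣stepMarks-path∣ t = trans (∣stepMarks-encode∣ t []) (+-comm _ 0)

patternSetOK-path : ∀ t → patternSetOK (steps (path t)) (stepMarks (path t)) ≡ not (lastBit (leafMarks t))
patternSetOK-path t =
  trans (patternSetOK≡marksGood (path t)) (trans (marksGood-path t) (cong not (sym (lastBit-leafMarks t))))

Stack : Set
Stack = List (Maybe MarkedTree)

fork : Bool → Maybe MarkedTree → Maybe MarkedTree → MarkedTree
fork b nothing  nothing  = leaf b
fork _ (just l) nothing  = left l
fork _ nothing  (just r) = right r
fork _ (just l) (just r) = both l r

pushStep : MStep → Stack → Stack
pushStep (D , _) st           = nothing ∷ st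
pushStep (U , b) (l ∷ r ∷ st) = just (fork b l r) ∷ st
pushStep (U , _) st           = st

decodeOnto : Word → Stack → Stack
decodeOnto w st = foldr pushStep st w

topTree : Stack → MarkedTree
topTree (just t ∷ _) = t
topTree _            = leaf false

-- The initial empty subtree stands for the missing final D of a path;
-- leaf false is a junk value for words that are not paths of trees.
decode : Word → MarkedTree
decode w = topTree (decodeOnto w (nothing ∷ []))

decodeOnto-encode : ∀ t rest st → decodeOnto (encode t (down ∷ rest)) st ≡ just t ∷ decodeOnto rest st
decodeOnto-encode (leaf b)   rest st = refl
decodeOnto-encode (left l)   rest st rewrite decodeOnto-encode l (down ∷ rest) st = refl
decodeOnto-encode (right r)  rest st rewrite decodeOnto-encode r rest st = refl
decodeOnto-encode (both l r) rest st
  rewrite decodeOnto-encode l (encode r (down ∷ rest)) st | decodeOnto-encode r rest st = refl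

decode-path : ∀ t → decode (path t) ≡ t
decode-path t = cong topTree $ begin
  decodeOnto (encode t []) (nothing ∷ [])  ≡⟨ foldr-++ pushStep [] (encode t []) (down ∷ []) ⟨
  decodeOnto (encode t [] ++ down ∷ []) [] ≡⟨ cong (λ w → decodeOnto w []) (encode-++ t [] (down ∷ [])) ⟩
  decodeOnto (encode t (down ∷ [])) []     ≡⟨ decodeOnto-encode t [] [] ⟩
  just t ∷ []                              ∎
  where open ≡-Reasoning

slot : Maybe MarkedTree → Word → Word
slot nothing  rest = rest
slot (just t) rest = encode t rest

encodeStack : Stack → Word
encodeStack []       = []
encodeStack (m ∷ st) = slot m (down ∷ encodeStack st)

encode-fork : ∀ l r rest → encode (fork false l r) rest ≡ up false ∷ slot l (down ∷ slot r rest)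
encode-fork nothing  nothing  rest = refl
encode-fork (just l) nothing  rest = refl
encode-fork nothing  (just r) rest = refl
encode-fork (just l) (just r) rest = refl

pushStep-up : ∀ st {h E} → length st ≡ suc (suc h) → encodeStack st ≡ E →
              length (pushStep (up false) st) ≡ suc h × encodeStack (pushStep (up false) st) ≡ up false ∷ E
pushStep-up (l ∷ r ∷ st) len refl = suc-injective len , encode-fork l r (down ∷ encodeStack st)

marked-up-DD : ∀ w → marksGood (up true ∷ w) ≡ true → Σ Word λ w′ → w ≡ down ∷ down ∷ w′ × marksGood w′ ≡ true
marked-up-DD (down ∷ down ∷ w)              ok = w , refl , ∧-conicalʳ (hasU (steps w)) _ ok
marked-up-DD ((D , true) ∷ (D , _) ∷ w)     ok = contradiction (∧-conicalʳ (hasU (steps w)) _ ok) λ ()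
marked-up-DD (down ∷ (D , true) ∷ w)        ok = contradiction (∧-conicalʳ (hasU (steps w)) _ ok) λ ()
marked-up-DD []                             ()
marked-up-DD ((U , _) ∷ _)                  ()
marked-up-DD ((D , _) ∷ [])                 ()
marked-up-DD ((D , _) ∷ (U , _) ∷ _)        ()

decodeOnto-valid : ∀ h w m st → isDyckFrom h (steps w) ≡ true → marksGood w ≡ true →
                   length (decodeOnto w (m ∷ st)) ≡ suc h + length st ×
                   encodeStack (decodeOnto w (m ∷ st)) ≡ w ++ encodeStack (m ∷ st)
decodeOnto-valid zero    []                m st dyck ok = refl , refl
decodeOnto-valid (suc h) []                m st () ok
decodeOnto-valid h       ((U , false) ∷ w) m st dyck ok =
  uncurry (pushStep-up (decodeOnto w (m ∷ st)))
          (decodeOnto-valid (suc h) w m st (trans (sym (isDyckFrom-U h (steps w))) dyck) ok)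
decodeOnto-valid h       ((U , true) ∷ w)  m st dyck ok with marked-up-DD w ok
decodeOnto-valid (suc h) ((U , true) ∷ _)  m st dyck ok | w , refl , ok′ =
  map₁ (cong suc) (map₂ (cong (λ e → up true ∷ down ∷ down ∷ e)) (decodeOnto-valid h w m st dyck ok′))
decodeOnto-valid zero    ((U , true) ∷ _)  m st () ok | w , refl , ok′
decodeOnto-valid (suc h) (down ∷ w)        m st dyck ok =
  map₁ (cong suc) (map₂ (cong (down ∷_)) (decodeOnto-valid h w m st dyck ok))
decodeOnto-valid zero    (down ∷ w)        m st () ok
decodeOnto-valid h       ((D , true) ∷ w)  m st dyck ()

path-decode : ∀ w → isDyck (steps w) ≡ true → marksGood w ≡ true → w ≢ [] → path (decode w) ≡ w
path-decode w dyck ok w≢[] with decodeOnto w (nothing ∷ []) | decodeOnto-valid 0 w nothing [] dyck ok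
... | just t ∷ [] | _ , enc  = ∷ʳ-injectiveˡ (path t) w (trans (encode-++ t [] (down ∷ [])) enc)
... | nothing ∷ [] | _ , enc = contradiction (sym (∷ʳ-injectiveˡ [] w enc)) w≢[]
... | []          | () , _
... | _ ∷ _ ∷ _   | () , _

TreeOK : ℕ → ℕ → MarkedTree → Set
TreeOK n k t = (size (shape t) ≡ n + k + 1) × (∣ leafMarks t ∣ ≡ k) × (lastBit (leafMarks t) ≡ false)

PathOK : ℕ → ℕ → Word → Set
PathOK n k w = (isDyck (steps w) ≡ true) × (length (steps w) ≡ 2 * (n + k + 1)) ×
               (∣ stepMarks w ∣ ≡ k) × (patternSetOK (steps w) (stepMarks w) ≡ true)

TreeOK⇔PathOK : ∀ n k t → TreeOK n k t ⇔ PathOK n k (path t)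
TreeOK⇔PathOK n k t = mk⇔
  (λ (sz , cnt , last) → isDyck-path t , trans (length-path t) (cong (2 *_) sz) , trans (∣stepMarks-path∣ t) cnt ,
                          trans (patternSetOK-path t) (cong not last))
  (λ (_ , len , cnt , pat) → *-cancelˡ-≡ _ _ 2 (trans (sym (length-path t)) len) , trans (sym (∣stepMarks-path∣ t)) cnt ,
                             trans (sym (not-involutive _)) (cong not (trans (sym (patternSetOK-path t)) pat)))

PathOK-path-decode : ∀ n k {w} → PathOK n k w → path (decode w) ≡ w
PathOK-path-decode n k {w} (dyck , len , _ , pat) =
  path-decode w dyck (trans (sym (patternSetOK≡marksGood w)) pat) nonempty
  where
  nonempty : w ≢ []
  nonempty refl = contradiction (trans len (cong (2 *_) (+-comm (n + k) 1))) λ ()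

theorem4 : (n k : ℕ) → LeafMarked n k ⤖ DyckMarked n k
theorem4 n k = ↔⇒⤖ $ begin
  LeafMarked n k                            ↔⟨ Σ-assoc ⟨
  Σ (Σ Tree (Subset ∘ numLeaves)) _        ↔⟨ Σ-↔ markedTree↔ ↔-refl ⟨
  Σ MarkedTree (TreeOK n k)                 ↔⟨ Σ-restrict-↔ path decode decode-path (PathOK-path-decode n k)
                                                             (TreeOK⇔PathOK n k) TreeOK-irr PathOK-irr ⟩
  Σ Word (PathOK n k)                       ↔⟨ Σ-↔ word↔ ↔-refl ⟩
  Σ (Σ (List Step) (Subset ∘ length)) _    ↔⟨ Σ-assoc ⟩
  DyckMarked n k                            ∎
  where
  open EquationalReasoning
  TreeOK-irr : ∀ t → Irrelevant (TreeOK n k t)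
  TreeOK-irr _ = ×-irrelevant uip (×-irrelevant uip uip)
  PathOK-irr : ∀ w → Irrelevant (PathOK n k w)
  PathOK-irr _ = ×-irrelevant uip (×-irrelevant uip (×-irrelevant uip uip))
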